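{- Let $X$ be a $(95,40,12,20)$ strongly regular graph and let $K$ be a $4$-clique of $X$ that is not contained in any $5$-clique of $X$. For $i\in\{0,1,2,3\}$ let $X_i$ be the set of vertices of $V(X)\setminus V(K)$ having exactly $i$ neighbours in $K$, and suppose $(|X_0|,|X_1|,|X_2|,|X_3|)=(1,34,54,2)$. Let $x_0$ be the unique vertex of $X_0$. Then each vertex of $X_3$ is adjacent to at least one vertex of $N(x_0)\cap X_1$ (the set of neighbours of $x_0$ lying in $X_1$).
   Context: A $k$-regular graph $G$ on $v$ vertices is a $(v,k,\lambda,\mu)$ strongly regular graph if any two distinct adjacent vertices have exactly $\lambda$ common neighbours and any two distinct non-adjacent vertices have exactly $\mu$ common neighbours. $N(x)$ denotes the set of neighbours of $x$. -}

module Defs where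

open import Data.Nat using (ℕ)
open import Data.Bool using (Bool; true; false; _∧_; not; T)
open import Data.Fin using (Fin)
open import Data.List using (List; length; filterᵇ; allFin)
open import Data.Product using (_×_; Σ; ∃)
open import Relation.Binary.PropositionalEquality using (_≡_; _≢_)
open import Relation.Nullary using (¬_)
open import Relation.Nullary.Decidable using (⌊_⌋)
import Data.Fin as F
open import Data.Bool.ListAction using (any)

record Graph (v : ℕ) : Set where
  field
    adj    : Fin v → Fin v → Bool
    sym    : ∀ x y → adj x y ≡ adj y x
    irrefl : ∀ x → adj x x ≡ false

#[_] : {n : ℕ} → (Fin n → Bool) → ℕ
#[_] {n} p = length (filterᵇ p (allFin n))

module _ {v : ℕ} (G : Graph v) where
  open Graph G

  Adj : Fin v → Fin v → Set
  Adj x y = adj x y ≡ true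

  degree : Fin v → ℕ
  degree x = #[ (λ y → adj x y) ]

  commonNbrs : Fin v → Fin v → ℕ
  commonNbrs x y = #[ (λ z → adj x z ∧ adj y z) ]

  IsSRG : ℕ → ℕ → ℕ → Set
  IsSRG k l m =
      (∀ x → degree x ≡ k)
    × (∀ x y → x ≢ y → Adj x y → commonNbrs x y ≡ l)
    × (∀ x y → x ≢ y → ¬ Adj x y → commonNbrs x y ≡ m)

  IsClique : {t : ℕ} → (Fin t → Fin v) → Set
  IsClique {t} K = ∀ (i j : Fin t) → i ≢ j → Adj (K i) (K j)

  _⊆ᵛ_ : {s t : ℕ} → (Fin s → Fin v) → (Fin t → Fin v) → Set
  _⊆ᵛ_ {s} {t} K C = ∀ (i : Fin s) → ∃ λ (j : Fin t) → C j ≡ K i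

  _∈ᵛ_ : {t : ℕ} → Fin v → (Fin t → Fin v) → Set
  _∈ᵛ_ {t} x K = ∃ λ (i : Fin t) → K i ≡ x

module _ {v : ℕ} (G : Graph v) {t : ℕ} (K : Fin t → Fin v) where
  open Graph G

  inK : Fin v → Bool
  inK x = any (λ i → ⌊ K i F.≟ x ⌋) (allFin t)

  -- number of neighbours of x in K (K is injective when it is a clique,
  -- so this counts vertices of K)
  nbrsInK : Fin v → ℕ
  nbrsInK x = #[ (λ i → adj x (K i)) ]

  inX : ℕ → Fin v → Bool
  inX i x = not (inK x) ∧ ⌊ nbrsInK x Data.Nat.≟ i ⌋

  InX : ℕ → Fin v → Set
  InX i x = inX i x ≡ true

  sizeX : ℕ → ℕ
  sizeX i = #[ inX i ]

-- Fix y ∈ X₃ and suppose that no vertex of N(x₀) ∩ X₁ is adjacent to y.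
-- Count the pairs (x , i) with x ∈ N(y) and x ∼ Kᵢ: by the parameters of X this is
-- Σᵢ |N(y) ∩ N(Kᵢ)| = 3·12 + 20 = 56.  On the other hand each x ∈ N(y) lies in
-- one of three classes: a vertex of K (3 of them, each with 3 neighbours in K),
-- possibly x₀ (no neighbours in K), or a vertex outside K ∪ {x₀}, which has at least
-- one neighbour in K because X₀ = {x₀}, and at least two if moreover x ∼ x₀.
-- Since |N(y) ∩ N(x₀)| ≥ 12, this forces at least 40 + 12 + 2·3 − 1 = 57 of them, a contradiction.
module Submission where

open import Defs
open import Data.Fin using (Fin)
open import Data.Product using (_×_; ∃)
open import Relation.Binary.PropositionalEquality using (_≡_)
open import Relation.Nullary using (¬_)

open import Data.Bool using (Bool; true; false; _∧_; not; if_then_else_)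
import Data.Bool as Bool
open import Data.Bool.Properties using (T-≡; ∧-zeroʳ)
open import Data.Empty using (⊥; ⊥-elim)
open import Data.Fin using (zero; suc)
open import Data.Fin.Properties using (_≟_; any?)
open import Data.List using (length; filterᵇ; tabulate; allFin)
open import Data.List.Membership.Propositional using (lose)
open import Data.List.Membership.Propositional.Properties using (∈-allFin)
open import Data.List.Relation.Unary.Any using (satisfied)
open import Data.List.Relation.Unary.Any.Properties using (any⁺; any⁻)
open import Data.Nat using (ℕ; zero; suc; _+_; _*_; _≤_; z≤n; s≤s)
import Data.Nat as ℕ
open import Data.Nat.Properties
  using ( +-*-semiring; +-comm; +-identityʳ; *-identityʳ; *-zeroʳ; suc-injective; +-cancelˡ-≡
        ; ≤-refl; ≤-reflexive; ≤-trans; 1+n≰n; m≤m+n; m≤n+m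
        ; +-mono-≤; +-monoˡ-≤; +-monoʳ-≤; *-monoʳ-≤; module ≤-Reasoning )
open import Data.Product using (_,_; proj₁; proj₂)
open import Function using (_∘_; id; Equivalence; case_of_)
open import Function.Definitions using (Injective)
open import Relation.Binary.PropositionalEquality
  using (_≢_; refl; sym; trans; cong; cong₂; subst; module ≡-Reasoning)
open import Relation.Nullary using (yes; no; _×-dec_)
open import Relation.Nullary.Decidable using (⌊_⌋; toWitness; fromWitness)

open import Algebra.Properties.Semiring.Sum +-*-semiring
  using (sum; sum-syntax; ∑-distrib-+; ∑-comm; sum-cong-≗; sum-replicate-zero; *-distribˡ-sum)
open Equivalence using (to; from)

toℕ : Bool → ℕ
toℕ false = 0
toℕ true  = 1

length-filterᵇ-tabulate : ∀ {A : Set} {n} (p : A → Bool) (f : Fin n → A) →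
                          length (filterᵇ p (tabulate f)) ≡ ∑[ i < n ] toℕ (p (f i))
length-filterᵇ-tabulate {n = zero}  p f = refl
length-filterᵇ-tabulate {n = suc n} p f with p (f zero)
... | true  = cong suc (length-filterᵇ-tabulate p (f ∘ suc))
... | false = length-filterᵇ-tabulate p (f ∘ suc)

toℕ≤1 : ∀ b → toℕ b ≤ 1
toℕ≤1 false = z≤n
toℕ≤1 true  = ≤-refl

#≡∑ : ∀ {n} (p : Fin n → Bool) → #[ p ] ≡ ∑[ i < n ] toℕ (p i)
#≡∑ p = length-filterᵇ-tabulate p id

∑-mono-≤ : ∀ {n} {f g : Fin n → ℕ} → (∀ i → f i ≤ g i) → sum f ≤ sum g
∑-mono-≤ {zero}  f≤g = z≤n
∑-mono-≤ {suc n} f≤g = +-mono-≤ (f≤g zero) (∑-mono-≤ (f≤g ∘ suc))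

∑-zero : ∀ {n} {f : Fin n → ℕ} → (∀ i → f i ≡ 0) → sum f ≡ 0
∑-zero {n} f≡0 = trans (sum-cong-≗ f≡0) (sum-replicate-zero n)

∑-one : ∀ n → ∑[ i < n ] 1 ≡ n
∑-one zero    = refl
∑-one (suc n) = cong suc (∑-one n)

term≤∑ : ∀ {n} (f : Fin n → ℕ) i → f i ≤ sum f
term≤∑ f zero    = m≤m+n _ _
term≤∑ f (suc i) = ≤-trans (term≤∑ (f ∘ suc) i) (m≤n+m _ _)

∑-≟≡1 : ∀ {n} (a : Fin n) → ∑[ x < n ] toℕ ⌊ a ≟ x ⌋ ≡ 1
∑-≟≡1 {suc n} zero    = cong suc (∑-zero {n} λ _ → refl)
∑-≟≡1 {suc n} (suc a) = trans (sum-cong-≗ (cong toℕ ∘ suc≟suc)) (∑-≟≡1 a)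
  where
  suc≟suc : ∀ x → ⌊ suc a ≟ suc x ⌋ ≡ ⌊ a ≟ x ⌋
  suc≟suc x with a ≟ x
  ... | yes _ = refl
  ... | no  _ = refl

#≡0⇒false : ∀ {n} (p : Fin n → Bool) → #[ p ] ≡ 0 → ∀ i → p i ≡ false
#≡0⇒false p #p≡0 i with p i | term≤∑ (toℕ ∘ p) i
... | false | _      = refl
... | true  | 1≤∑p = ⊥-elim (1+n≰n (subst (1 ≤_) (trans (sym (#≡∑ p)) #p≡0) 1≤∑p))

#≤1⇒unique : ∀ {n} (p : Fin n → Bool) → #[ p ] ≤ 1 →
             ∀ {a b} → p a ≡ true → p b ≡ true → a ≡ b
#≤1⇒unique {n} p #p≤1 {a} {b} pa pb with a ≟ b
... | yes a≡b = a≡b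
... | no  a≢b = ⊥-elim (1+n≰n (≤-trans 2≤#p #p≤1))
  where
  two-indicators≤p : ∀ x → toℕ ⌊ a ≟ x ⌋ + toℕ ⌊ b ≟ x ⌋ ≤ toℕ (p x)
  two-indicators≤p x with a ≟ x | b ≟ x
  ... | yes refl | yes refl = ⊥-elim (a≢b refl)
  ... | yes refl | no  _    rewrite pa = ≤-refl
  ... | no  _    | yes refl rewrite pb = ≤-refl
  ... | no  _    | no  _    = z≤n
  open ≤-Reasoning
  2≤#p : 2 ≤ #[ p ]
  2≤#p = begin
    2
      ≡⟨ cong₂ _+_ (∑-≟≡1 a) (∑-≟≡1 b) ⟨
    ∑[ x < n ] toℕ ⌊ a ≟ x ⌋ + ∑[ x < n ] toℕ ⌊ b ≟ x ⌋
      ≡⟨ ∑-distrib-+ (λ x → toℕ ⌊ a ≟ x ⌋) (λ x → toℕ ⌊ b ≟ x ⌋) ⟨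
    ∑[ x < n ] (toℕ ⌊ a ≟ x ⌋ + toℕ ⌊ b ≟ x ⌋)
      ≤⟨ ∑-mono-≤ two-indicators≤p ⟩
    ∑[ x < n ] toℕ (p x)
      ≡⟨ #≡∑ p ⟨
    #[ p ]
      ∎

∑-toℕ+∑-toℕ-not : ∀ {n} (b : Fin n → Bool) →
                  ∑[ i < n ] toℕ (b i) + ∑[ i < n ] toℕ (not (b i)) ≡ n
∑-toℕ+∑-toℕ-not {n} b = begin
  ∑[ i < n ] toℕ (b i) + ∑[ i < n ] toℕ (not (b i))  ≡⟨ ∑-distrib-+ (toℕ ∘ b) (toℕ ∘ not ∘ b) ⟨
  ∑[ i < n ] (toℕ (b i) + toℕ (not (b i)))          ≡⟨ sum-cong-≗ (toℕ+toℕ-not ∘ b) ⟩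
  ∑[ i < n ] 1                                      ≡⟨ ∑-one n ⟩
  n                                                 ∎
  where
  open ≡-Reasoning
  toℕ+toℕ-not : ∀ c → toℕ c + toℕ (not c) ≡ 1
  toℕ+toℕ-not true  = refl
  toℕ+toℕ-not false = refl

∑-if : ∀ {n} (b : Fin n → Bool) (l m : ℕ) →
       ∑[ i < n ] (if b i then l else m)
         ≡ l * ∑[ i < n ] toℕ (b i) + m * ∑[ i < n ] toℕ (not (b i))
∑-if {n} b l m = begin
  ∑[ i < n ] (if b i then l else m)
    ≡⟨ sum-cong-≗ (if≡ ∘ b) ⟩
  ∑[ i < n ] (l * toℕ (b i) + m * toℕ (not (b i)))
    ≡⟨ ∑-distrib-+ (λ i → l * toℕ (b i)) (λ i → m * toℕ (not (b i))) ⟩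
  ∑[ i < n ] (l * toℕ (b i)) + ∑[ i < n ] (m * toℕ (not (b i)))
    ≡⟨ cong₂ _+_ (*-distribˡ-sum l (toℕ ∘ b)) (*-distribˡ-sum m (toℕ ∘ not ∘ b)) ⟨
  l * ∑[ i < n ] toℕ (b i) + m * ∑[ i < n ] toℕ (not (b i))
    ∎
  where
  open ≡-Reasoning
  if≡ : ∀ c → (if c then l else m) ≡ l * toℕ c + m * toℕ (not c)
  if≡ true  = sym (trans (cong₂ _+_ (*-identityʳ l) (*-zeroʳ m)) (+-identityʳ l))
  if≡ false = sym (trans (cong (_+ m * 1) (*-zeroʳ l)) (*-identityʳ m))

∑-∑-indicator : ∀ {t n} (K : Fin t → Fin n) (b : Fin t → Bool) →
                ∑[ x < n ] ∑[ i < t ] toℕ (b i ∧ ⌊ K i ≟ x ⌋) ≡ ∑[ i < t ] toℕ (b i)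
∑-∑-indicator {t} {n} K b = trans (∑-comm (λ x i → toℕ (b i ∧ ⌊ K i ≟ x ⌋))) (sum-cong-≗ row)
  where
  row : ∀ i → ∑[ x < n ] toℕ (b i ∧ ⌊ K i ≟ x ⌋) ≡ toℕ (b i)
  row i with b i
  ... | true  = ∑-≟≡1 (K i)
  ... | false = ∑-zero {n} λ _ → refl

∑-indicator≤1 : ∀ {t n} {K : Fin t → Fin n} → Injective _≡_ _≡_ K →
                        ∀ (b : Fin t → Bool) j → ∑[ i < t ] toℕ (b i ∧ ⌊ K i ≟ K j ⌋) ≤ 1
∑-indicator≤1 {t} {K = K} K-inj b j =
  subst (∑[ i < t ] toℕ (b i ∧ ⌊ K i ≟ K j ⌋) ≤_) (∑-≟≡1 j) (∑-mono-≤ term≤indicator)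
  where
  term≤indicator : ∀ i → toℕ (b i ∧ ⌊ K i ≟ K j ⌋) ≤ toℕ ⌊ j ≟ i ⌋
  term≤indicator i with j ≟ i
  ... | yes _ = toℕ≤1 _
  ... | no j≢i with K i ≟ K j
  ...   | yes Ki≡Kj = ⊥-elim (j≢i (sym (K-inj Ki≡Kj)))
  ...   | no _ rewrite ∧-zeroʳ (b i) = z≤n

module _ {v : ℕ} (G : Graph v) where
  open Graph G renaming (sym to adj-sym)

  Adj-irrefl : ∀ {x y} → Adj G x y → x ≢ y
  Adj-irrefl {x} x∼y refl with () ← trans (sym (irrefl x)) x∼y

  clique-injective : ∀ {t} {K : Fin t → Fin v} → IsClique G K → Injective _≡_ _≡_ K
  clique-injective {K = K} K-clique {i} {j} Ki≡Kj with i ≟ j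
  ... | yes i≡j = i≡j
  ... | no  i≢j = ⊥-elim (Adj-irrefl (K-clique i j i≢j) Ki≡Kj)

  commonNbrs-srg : ∀ {k l m} → IsSRG G k l m →
                   ∀ {x y} → x ≢ y → commonNbrs G x y ≡ (if adj x y then l else m)
  commonNbrs-srg (_ , adjacent , non-adjacent) {x} {y} x≢y with adj x y in x∼y
  ... | true  = adjacent x y x≢y x∼y
  ... | false = non-adjacent x y x≢y λ x∼y′ → case trans (sym x∼y) x∼y′ of λ ()

  ∑-commonNbrs : ∀ {t} (K : Fin t → Fin v) y →
                 ∑[ x < v ] ∑[ i < t ] toℕ (adj y x ∧ adj x (K i)) ≡ ∑[ i < t ] commonNbrs G y (K i)
  ∑-commonNbrs {t} K y = trans (∑-comm (λ x i → toℕ (adj y x ∧ adj x (K i)))) (sum-cong-≗ column)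
    where
    column : ∀ i → ∑[ x < v ] toℕ (adj y x ∧ adj x (K i)) ≡ commonNbrs G y (K i)
    column i = trans (sum-cong-≗ λ x → cong (toℕ ∘ (adj y x ∧_)) (adj-sym x (K i))) (sym (#≡∑ λ z → adj y z ∧ adj (K i) z))

module _ {v : ℕ} (G : Graph v) {t : ℕ} (K : Fin t → Fin v) where
  open Graph G using (adj; irrefl)

  ∈ᵛ⇒inK : ∀ {x} → _∈ᵛ_ G x K → inK G K x ≡ true
  ∈ᵛ⇒inK (i , Ki≡x) = to T-≡ (any⁺ _ (lose (∈-allFin i) (fromWitness Ki≡x)))

  inK⇒∈ᵛ : ∀ {x} → inK G K x ≡ true → _∈ᵛ_ G x K
  inK⇒∈ᵛ {x} x∈K with i , Ki≟x ← satisfied (any⁻ (λ i → ⌊ K i ≟ x ⌋) (allFin t) (from T-≡ x∈K)) =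
    i , toWitness Ki≟x

  InX⁻ : ∀ {i x} → InX G K i x → inK G K x ≡ false × nbrsInK G K x ≡ i
  InX⁻ {i} {x} x∈Xᵢ with inK G K x | nbrsInK G K x ℕ.≟ i
  InX⁻ x∈Xᵢ | false | yes #≡i = refl , #≡i

  InX⁺ : ∀ {i x} → inK G K x ≡ false → nbrsInK G K x ≡ i → InX G K i x
  InX⁺ {i} {x} x∉K #≡i rewrite x∉K with nbrsInK G K x ℕ.≟ i
  ... | yes _  = refl
  ... | no #≢i = ⊥-elim (#≢i #≡i)

  clique-nbrsInK : IsClique G K → ∀ j → suc (nbrsInK G K (K j)) ≡ t
  clique-nbrsInK K-clique j = begin
    suc (nbrsInK G K (K j))
      ≡⟨ +-comm 1 _ ⟩
    nbrsInK G K (K j) + 1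
      ≡⟨ cong₂ _+_ (#≡∑ (adj (K j) ∘ K)) (sym (∑-≟≡1 j)) ⟩
    ∑[ i < t ] toℕ (adj (K j) (K i)) + ∑[ i < t ] toℕ ⌊ j ≟ i ⌋
      ≡⟨ ∑-distrib-+ (toℕ ∘ adj (K j) ∘ K) (toℕ ∘ ⌊_⌋ ∘ (j ≟_)) ⟨
    ∑[ i < t ] (toℕ (adj (K j) (K i)) + toℕ ⌊ j ≟ i ⌋)
      ≡⟨ sum-cong-≗ adjacent-or-equal ⟩
    ∑[ i < t ] 1
      ≡⟨ ∑-one t ⟩
    t
      ∎
    where
    open ≡-Reasoning
    adjacent-or-equal : ∀ i → toℕ (adj (K j) (K i)) + toℕ ⌊ j ≟ i ⌋ ≡ 1
    adjacent-or-equal i with j ≟ i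
    ... | yes refl rewrite irrefl (K j)    = refl
    ... | no  j≢i  rewrite K-clique j i j≢i = refl

module NoCommonNeighbour
  {v : ℕ} (G : Graph v) (srg : IsSRG G 40 12 20)
  (K : Fin 4 → Fin v) (K-clique : IsClique G K) (|X₀|≡1 : sizeX G K 0 ≡ 1)
  (x₀ : Fin v) (x₀∈X₀ : InX G K 0 x₀) (y : Fin v) (y∈X₃ : InX G K 3 y)
  (no-common : ¬ (∃ λ z → Adj G x₀ z × InX G K 1 z × Adj G y z))
  where
  open Graph G using (adj; irrefl)

  x₀∉K : inK G K x₀ ≡ false
  x₀∉K = proj₁ (InX⁻ G K x₀∈X₀)

  y∉K : inK G K y ≡ false
  y∉K = proj₁ (InX⁻ G K y∈X₃)

  ∉K⇒≢ : ∀ {x} → inK G K x ≡ false → ∀ i → x ≢ K i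
  ∉K⇒≢ x∉K i refl with () ← trans (sym x∉K) (∈ᵛ⇒inK G K (i , refl))

  x₀≁K : ∀ i → adj x₀ (K i) ≡ false
  x₀≁K = #≡0⇒false (adj x₀ ∘ K) (proj₂ (InX⁻ G K x₀∈X₀))

  X₀≡x₀ : ∀ {x} → InX G K 0 x → x ≡ x₀
  X₀≡x₀ x∈X₀ = #≤1⇒unique (inX G K 0) (≤-reflexive |X₀|≡1) x∈X₀ x₀∈X₀

  neighbour-outside-K : ∀ {x} → inK G K x ≡ false → x₀ ≢ x → adj y x ≡ true →
                        suc (toℕ (adj x₀ x)) ≤ nbrsInK G K x
  neighbour-outside-K {x} x∉K x₀≢x y∼x with nbrsInK G K x in #x | adj x₀ x in x₀∼x
  ... | 0           | _     = ⊥-elim (x₀≢x (sym (X₀≡x₀ (InX⁺ G K x∉K #x))))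
  ... | 1           | true  = ⊥-elim (no-common (x , x₀∼x , InX⁺ G K x∉K #x , y∼x))
  ... | 1           | false = ≤-refl
  ... | suc (suc _) | b     = s≤s (≤-trans (toℕ≤1 b) (s≤s z≤n))

  -- The indicator of x ∈ V(K) ∩ N(y), written as a sum over K so that it can be
  -- summed over x by exchanging the two sums.
  𝟙K∩Ny : Fin v → ℕ
  𝟙K∩Ny x = ∑[ i < 4 ] toℕ (adj y (K i) ∧ ⌊ K i ≟ x ⌋)

  𝟙K∩Ny-outside-K : ∀ {x} → inK G K x ≡ false → 𝟙K∩Ny x ≡ 0
  𝟙K∩Ny-outside-K {x} x∉K = ∑-zero term≡0
    where
    term≡0 : ∀ i → toℕ (adj y (K i) ∧ ⌊ K i ≟ x ⌋) ≡ 0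
    term≡0 i with K i ≟ x
    ... | yes refl = ⊥-elim (∉K⇒≢ x∉K i refl)
    ... | no  _    = cong toℕ (∧-zeroʳ (adj y (K i)))

  𝟙K∩Ny-outside-N : ∀ {x} → adj y x ≡ false → 𝟙K∩Ny x ≡ 0
  𝟙K∩Ny-outside-N {x} y≁x = ∑-zero term≡0
    where
    term≡0 : ∀ i → toℕ (adj y (K i) ∧ ⌊ K i ≟ x ⌋) ≡ 0
    term≡0 i with K i ≟ x
    ... | yes refl rewrite y≁x = refl
    ... | no  _    = cong toℕ (∧-zeroʳ (adj y (K i)))

  𝟙K∩Ny≤1 : ∀ j → 𝟙K∩Ny (K j) ≤ 1
  𝟙K∩Ny≤1 = ∑-indicator≤1 (clique-injective G K-clique) (adj y ∘ K)

  ∑-adj-K≡3 : ∀ j → ∑[ i < 4 ] toℕ (adj (K j) (K i)) ≡ 3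
  ∑-adj-K≡3 j = trans (sym (#≡∑ (adj (K j) ∘ K))) (suc-injective (clique-nbrsInK G K K-clique j))

  weight : Fin v → ℕ
  weight x = 2 * 𝟙K∩Ny x + (toℕ (adj y x) + toℕ (adj y x ∧ adj x₀ x))

  -- The term [x = x₀] pays for x₀, which may lie in N(y) but has no neighbour in K.
  incidences : Fin v → ℕ
  incidences x = toℕ ⌊ x₀ ≟ x ⌋ + ∑[ i < 4 ] toℕ (adj y x ∧ adj x (K i))

  weight≤incidences : ∀ x → weight x ≤ incidences x
  weight≤incidences x with adj y x in y∼x
  ... | false rewrite 𝟙K∩Ny-outside-N y∼x = z≤n
  ... | true with x₀ ≟ x
  ...   | yes refl rewrite 𝟙K∩Ny-outside-K x₀∉K | irrefl x₀ = s≤s z≤n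
  ...   | no x₀≢x with inK G K x in inK-x
  ...     | false rewrite 𝟙K∩Ny-outside-K inK-x =
              subst (_ ≤_) (#≡∑ (adj x ∘ K)) (neighbour-outside-K inK-x x₀≢x y∼x)
  ...     | true with inK⇒∈ᵛ G K inK-x
  ...       | j , refl rewrite x₀≁K j =
                ≤-trans (+-monoˡ-≤ 1 (*-monoʳ-≤ 2 (𝟙K∩Ny≤1 j))) (≤-reflexive (sym (∑-adj-K≡3 j)))

  ∑-adj-y-K : ∑[ i < 4 ] toℕ (adj y (K i)) ≡ 3
  ∑-adj-y-K = trans (sym (#≡∑ (adj y ∘ K))) (proj₂ (InX⁻ G K y∈X₃))

  ∑-nonadj-y-K : ∑[ i < 4 ] toℕ (not (adj y (K i))) ≡ 1
  ∑-nonadj-y-K = +-cancelˡ-≡ 3 _ 1 (begin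
    3 + ∑[ i < 4 ] toℕ (not (adj y (K i)))
      ≡⟨ cong (_+ ∑[ i < 4 ] toℕ (not (adj y (K i)))) ∑-adj-y-K ⟨
    ∑[ i < 4 ] toℕ (adj y (K i)) + ∑[ i < 4 ] toℕ (not (adj y (K i)))
      ≡⟨ ∑-toℕ+∑-toℕ-not (adj y ∘ K) ⟩
    4
      ∎)
    where open ≡-Reasoning

  y≢x₀ : y ≢ x₀
  y≢x₀ refl with () ← trans (sym (proj₂ (InX⁻ G K y∈X₃))) (proj₂ (InX⁻ G K x₀∈X₀))

  12≤commonNbrs : 12 ≤ commonNbrs G y x₀
  12≤commonNbrs rewrite commonNbrs-srg G srg y≢x₀ with adj y x₀
  ... | true  = ≤-refl
  ... | false = m≤m+n 12 8

  ∑-weight : ∑[ x < v ] weight x ≡ 2 * 3 + (40 + commonNbrs G y x₀)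
  ∑-weight = begin
    ∑[ x < v ] weight x
      ≡⟨ ∑-distrib-+ (λ x → 2 * 𝟙K∩Ny x) (λ x → toℕ (adj y x) + toℕ (adj y x ∧ adj x₀ x)) ⟩
    ∑[ x < v ] (2 * 𝟙K∩Ny x) + ∑[ x < v ] (toℕ (adj y x) + toℕ (adj y x ∧ adj x₀ x))
      ≡⟨ cong₂ _+_ (sym (*-distribˡ-sum 2 𝟙K∩Ny)) (∑-distrib-+ (toℕ ∘ adj y) (λ x → toℕ (adj y x ∧ adj x₀ x))) ⟩
    2 * ∑[ x < v ] 𝟙K∩Ny x + (∑[ x < v ] toℕ (adj y x) + ∑[ x < v ] toℕ (adj y x ∧ adj x₀ x))
      ≡⟨ cong₂ (λ a b → 2 * a + b) (trans (∑-∑-indicator K (adj y ∘ K)) ∑-adj-y-K)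
                                   (cong₂ _+_ (sym (#≡∑ (adj y))) (sym (#≡∑ λ x → adj y x ∧ adj x₀ x))) ⟩
    2 * 3 + (degree G y + commonNbrs G y x₀)
      ≡⟨ cong (λ d → 2 * 3 + (d + commonNbrs G y x₀)) (proj₁ srg y) ⟩
    2 * 3 + (40 + commonNbrs G y x₀)
      ∎
    where open ≡-Reasoning

  ∑-incidences : ∑[ x < v ] incidences x ≡ 1 + (12 * 3 + 20 * 1)
  ∑-incidences = begin
    ∑[ x < v ] incidences x
      ≡⟨ ∑-distrib-+ (λ x → toℕ ⌊ x₀ ≟ x ⌋) (λ x → ∑[ i < 4 ] toℕ (adj y x ∧ adj x (K i))) ⟩
    ∑[ x < v ] toℕ ⌊ x₀ ≟ x ⌋ + ∑[ x < v ] ∑[ i < 4 ] toℕ (adj y x ∧ adj x (K i))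
      ≡⟨ cong₂ _+_ (∑-≟≡1 x₀) (∑-commonNbrs G K y) ⟩
    1 + ∑[ i < 4 ] commonNbrs G y (K i)
      ≡⟨ cong (1 +_) (sum-cong-≗ λ i → commonNbrs-srg G srg (∉K⇒≢ y∉K i)) ⟩
    1 + ∑[ i < 4 ] (if adj y (K i) then 12 else 20)
      ≡⟨ cong (1 +_) (∑-if (adj y ∘ K) 12 20) ⟩
    1 + (12 * ∑[ i < 4 ] toℕ (adj y (K i)) + 20 * ∑[ i < 4 ] toℕ (not (adj y (K i))))
      ≡⟨ cong₂ (λ a b → 1 + (12 * a + 20 * b)) ∑-adj-y-K ∑-nonadj-y-K ⟩
    1 + (12 * 3 + 20 * 1)
      ∎
    where open ≡-Reasoning

  absurd : ⊥
  absurd = 1+n≰n (begin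
    58                                ≤⟨ +-monoʳ-≤ (2 * 3) (+-monoʳ-≤ 40 12≤commonNbrs) ⟩
    2 * 3 + (40 + commonNbrs G y x₀)  ≡⟨ ∑-weight ⟨
    ∑[ x < v ] weight x               ≤⟨ ∑-mono-≤ weight≤incidences ⟩
    ∑[ x < v ] incidences x           ≡⟨ ∑-incidences ⟩
    57                                ∎)
    where open ≤-Reasoning

lemma6 : (G : Graph 95) → IsSRG G 40 12 20
       → (K : Fin 4 → Fin 95) → IsClique G K
       → ¬ (∃ λ (C : Fin 5 → Fin 95) → IsClique G C × _⊆ᵛ_ G K C)
       → sizeX G K 0 ≡ 1 → sizeX G K 1 ≡ 34
       → sizeX G K 2 ≡ 54 → sizeX G K 3 ≡ 2
       → (x₀ : Fin 95) → InX G K 0 x₀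
       → (y : Fin 95) → InX G K 3 y
       → ∃ λ (z : Fin 95) → Adj G x₀ z × InX G K 1 z × Adj G y z
lemma6 G srg K K-clique _ |X₀|≡1 _ _ _ x₀ x₀∈X₀ y y∈X₃
  with any? (λ z → Graph.adj G x₀ z Bool.≟ true ×-dec inX G K 1 z Bool.≟ true ×-dec Graph.adj G y z Bool.≟ true)
... | yes common = common
... | no  none   = ⊥-elim (NoCommonNeighbour.absurd G srg K K-clique |X₀|≡1 x₀ x₀∈X₀ y y∈X₃ none)
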